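{- A connected claw-free even graph is equimatchable if and only if it is isomorphic to $K_{2p}$ for some $p\ge1$ or to $C_4$.
   Context: A graph is equimatchable if all its maximal matchings have the same cardinality; claw-free if it has no induced $K_{1,3}$; even if it has an even number of vertices. $K_p$ and $C_p$ are the complete graph and cycle on $p$ vertices. -}

module Defs where

open import Data.Nat using (ℕ; suc; _+_; _<_; _≤_)
open import Data.Nat.DivMod using (_%_)
open import Data.Fin using (Fin; toℕ)
open import Data.Bool using (Bool; true; false; _∨_)
open import Data.Nat using (_≡ᵇ_)
open import Data.List using (List; []; _∷_; length; concatMap)
open import Data.List.Membership.Propositional using (_∈_)
open import Data.List.Relation.Unary.All using (All)
open import Data.List.Relation.Unary.Unique.Propositional using (Unique)
open import Data.Product using (_×_; _,_; proj₁; proj₂; ∃-syntax)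
open import Data.Sum using (_⊎_)
open import Relation.Binary.PropositionalEquality using (_≡_; _≢_)
open import Relation.Nullary using (¬_)
open import Function.Bundles using (_↔_; Inverse)

record Graph : Set where
  field
    n      : ℕ
    adj    : Fin n → Fin n → Bool
    sym    : ∀ u v → adj u v ≡ adj v u
    irrefl : ∀ u → adj u u ≡ false
open Graph public

data Walk (G : Graph) : Fin (n G) → Fin (n G) → Set where
  here : ∀ {u} → Walk G u u
  step : ∀ {u v w} → adj G u v ≡ true → Walk G v w → Walk G u w

Connected : Graph → Set
Connected G = (1 ≤ n G) × (∀ u v → Walk G u v)

Even : Graph → Set
Even G = ∃[ k ] n G ≡ k + k

ClawFree : Graph → Set
ClawFree G = ∀ (c a b d : Fin (n G)) →
  ¬ ( adj G c a ≡ true × adj G c b ≡ true × adj G c d ≡ true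
    × a ≢ b × a ≢ d × b ≢ d
    × adj G a b ≡ false × adj G a d ≡ false × adj G b d ≡ false )

endpoints : {G : Graph} → List (Fin (n G) × Fin (n G)) → List (Fin (n G))
endpoints = concatMap (λ e → proj₁ e ∷ proj₂ e ∷ [])

record Matching (G : Graph) : Set where
  field
    edges    : List (Fin (n G) × Fin (n G))
    areEdges : All (λ e → adj G (proj₁ e) (proj₂ e) ≡ true) edges
    disjoint : Unique (endpoints {G} edges)
open Matching public

size : {G : Graph} → Matching G → ℕ
size M = length (edges M)

Maximal : (G : Graph) → Matching G → Set
Maximal G M = ∀ u v → adj G u v ≡ true →
  (u ∈ endpoints {G} (edges M)) ⊎ (v ∈ endpoints {G} (edges M))

Equimatchable : Graph → Set
Equimatchable G = ∀ (M M' : Matching G) → Maximal G M → Maximal G M' → size M ≡ size M'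

record _≅_ (G H : Graph) : Set where
  field
    bij      : Fin (n G) ↔ Fin (n H)
    preserve : ∀ u v → adj G u v ≡ adj H (Inverse.to bij u) (Inverse.to bij v)

neqᵇ : ℕ → ℕ → Bool
neqᵇ a b with a ≡ᵇ b
... | true  = false
... | false = true

K : ℕ → Graph
K p = record
  { n = p
  ; adj = λ i j → neqᵇ (toℕ i) (toℕ j)
  ; sym = λ i j → symK (toℕ i) (toℕ j)
  ; irrefl = λ i → irrK (toℕ i) }
  where
  symK : ∀ a b → neqᵇ a b ≡ neqᵇ b a
  symK ℕ.zero ℕ.zero = _≡_.refl
  symK ℕ.zero (suc b) = _≡_.refl
  symK (suc a) ℕ.zero = _≡_.refl
  symK (suc a) (suc b) = symK a b
  irrK : ∀ a → neqᵇ a a ≡ false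
  irrK ℕ.zero = _≡_.refl
  irrK (suc a) = irrK a

-- Cycle C_4 on vertices 0,1,2,3 with edges 01,12,23,30.
c4adj : Fin 4 → Fin 4 → Bool
c4adj i j = (((toℕ i + 1) % 4) ≡ᵇ toℕ j) ∨ (((toℕ j + 1) % 4) ≡ᵇ toℕ i)

C4 : Graph
C4 = record
  { n = 4
  ; adj = c4adj
  ; sym = symC
  ; irrefl = irrC }
  where
  open import Data.Fin.Patterns
  symC : ∀ u v → c4adj u v ≡ c4adj v u
  symC 0F 0F = _≡_.refl
  symC 0F 1F = _≡_.refl
  symC 0F 2F = _≡_.refl
  symC 0F 3F = _≡_.refl
  symC 1F 0F = _≡_.refl
  symC 1F 1F = _≡_.refl
  symC 1F 2F = _≡_.refl
  symC 1F 3F = _≡_.refl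
  symC 2F 0F = _≡_.refl
  symC 2F 1F = _≡_.refl
  symC 2F 2F = _≡_.refl
  symC 2F 3F = _≡_.refl
  symC 3F 0F = _≡_.refl
  symC 3F 1F = _≡_.refl
  symC 3F 2F = _≡_.refl
  symC 3F 3F = _≡_.refl
  irrC : ∀ u → c4adj u u ≡ false
  irrC 0F = _≡_.refl
  irrC 1F = _≡_.refl
  irrC 2F = _≡_.refl
  irrC 3F = _≡_.refl

module Submission where

-- If every maximal matching exposes at most one vertex, parity makes all maximal
-- matchings perfect, hence of size n/2; this holds in K₂ₚ and, by inspection, in C₄.
-- Conversely, let G be connected, claw-free, even and equimatchable, so every matching as large
-- as a maximal one is maximal. Two exposed vertices s ≠ t of such a matching cannot be joined by
-- a walk: following it, s can always be traded for an exposed vertex next to the current vertex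
-- v (by rematching v's matching edge) unless s, the next vertex and the partner of v form a claw
-- at v, and arriving at t exposes an edge. So all maximal matchings are perfect. If G is not
-- complete, it has an induced path a b c; extending ab to a perfect matching matches c to some
-- c′, and rematching shows that a b c c′ is an induced 4-cycle none of whose vertices has a
-- further neighbour, so G ≅ C₄ by connectivity.

open import Defs hiding (sym)
open import Data.Bool using (true; false; T)
open import Data.Unit using (tt)
open import Data.Empty using (⊥; ⊥-elim)
open import Data.Fin using (Fin; zero; suc; toℕ)
open import Data.Fin.Patterns using (0F; 1F; 2F; 3F)
open import Data.Fin.Properties using (_≟_; any?; all?; toℕ-injective)
open import Data.List using (List; []; _∷_; [_]; _++_; length; lookup)
open import Data.List.Properties using (length-++; length-tabulate; length-removeAt′; ++-assoc)
open import Data.List.Membership.Propositional using (_∈_; _∉_)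
open import Data.List.Membership.Propositional.Properties using (∈-allFin; ∈-lookup; ∈-++⁻)
import Data.List.Membership.DecPropositional as DecMembership
open import Data.List.Relation.Binary.Permutation.Propositional
  using (_↭_; ↭-refl; ↭-sym; ↭-trans; ↭-prep; ↭-swap; ↭⇒↭ₛ)
open import Data.List.Relation.Binary.Permutation.Propositional.Properties
  using (++-commutativeMonoid; ++-comm; ∈-resp-↭; shifts)
open import Data.List.Relation.Binary.Subset.Propositional using (_⊆_)
open import Data.List.Relation.Unary.All using (All; []; _∷_)
open import Data.List.Relation.Unary.AllPairs using ([]; _∷_)
import Data.List.Relation.Unary.All as All
open import Data.List.Relation.Unary.All.Properties using (¬Any⇒All¬; All¬⇒¬Any; ++⁻ˡ)
open import Data.List.Relation.Unary.Any using (here; there; index; _─_)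
open import Data.List.Relation.Unary.Any.Properties using (lookup-index)
open import Data.List.Relation.Unary.Unique.Propositional using (Unique)
open import Data.List.Relation.Unary.Unique.Propositional.Properties using (allFin⁺)
import Data.List.Relation.Binary.Permutation.Setoid.Properties as Permutationₛ
open import Data.Nat using (ℕ; zero; suc; _+_; _*_; _≤_; z≤n; s≤s; ⌊_/2⌋; _≡ᵇ_)
open import Data.Nat.Properties
  using (≡ᵇ⇒≡; m≢1+n+m; ≤-antisym; ≤-trans; n≤1+n; m≤n+m; +-suc; +-identityʳ; <-irrefl; even≢odd; n≡⌊n+n/2⌋)
open import Data.Product using (∃-syntax; _×_; _,_; proj₁; proj₂)
open import Data.Sum using (_⊎_; inj₁; inj₂)
open import Function using (id; _∘_)
open import Function.Bundles using (mk↔ₛ′; _⇔_; mk⇔; Inverse; Injection)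
open import Function.Properties.Inverse using (↔⇒↣)
open import Function.Construct.Identity using (↔-id)
open import Relation.Nullary using (¬_; Dec; yes; no; contradiction)
open import Relation.Nullary.Decidable using (_×-dec_; ¬?; from-yes)
import Data.Bool.Properties as Bool
open import Relation.Binary.PropositionalEquality
  using (_≡_; _≢_; refl; sym; trans; cong; cong₂; subst; setoid; module ≡-Reasoning)

_∈?_ : ∀ {n} (v : Fin n) xs → Dec (v ∈ xs)
_∈?_ = DecMembership._∈?_ _≟_

Unique-resp-↭ : ∀ {A : Set} {xs ys : List A} → xs ↭ ys → Unique xs → Unique ys
Unique-resp-↭ {A} p = Permutationₛ.Unique-resp-↭ (setoid A) (↭⇒↭ₛ p)

Unique-++⁻ˡ : ∀ {A : Set} (xs : List A) {ys} → Unique (xs ++ ys) → Unique xs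
Unique-++⁻ˡ [] _ = []
Unique-++⁻ˡ (x ∷ xs) (x∉ ∷ xs!) = ++⁻ˡ xs x∉ ∷ Unique-++⁻ˡ xs xs!

Unique-lookup-injective : ∀ {A : Set} {xs : List A} → Unique xs →
  ∀ {i j} → lookup xs i ≡ lookup xs j → i ≡ j
Unique-lookup-injective (_ ∷ _) {zero} {zero} _ = refl
Unique-lookup-injective (x∉ ∷ _) {zero} {suc j} x≡ = ⊥-elim (All.lookup x∉ (∈-lookup j) x≡)
Unique-lookup-injective (x∉ ∷ _) {suc i} {zero} ≡x = ⊥-elim (All.lookup x∉ (∈-lookup i) (sym ≡x))
Unique-lookup-injective (_ ∷ xs!) {suc i} {suc j} eq = cong suc (Unique-lookup-injective xs! eq)

∈-─ : ∀ {A : Set} {x z : A} {ys} (x∈ys : x ∈ ys) → z ∈ ys → x ≢ z → z ∈ (ys ─ x∈ys)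
∈-─ (here refl) (here refl) x≢z = ⊥-elim (x≢z refl)
∈-─ (here refl) (there z∈ys) _ = z∈ys
∈-─ (there _) (here refl) _ = here refl
∈-─ (there x∈ys) (there z∈ys) x≢z = there (∈-─ x∈ys z∈ys x≢z)

Unique-⊆⇒length≤ : ∀ {A : Set} {xs ys : List A} → Unique xs → xs ⊆ ys → length xs ≤ length ys
Unique-⊆⇒length≤ [] _ = z≤n
Unique-⊆⇒length≤ {xs = x ∷ xs} {ys} (x∉xs ∷ xs!) xs⊆ys =
  subst (suc (length xs) ≤_) (sym (length-removeAt′ ys (index x∈ys)))
    (s≤s (Unique-⊆⇒length≤ xs! (λ z∈xs → ∈-─ x∈ys (xs⊆ys (there z∈xs)) (All.lookup x∉xs z∈xs))))
  where x∈ys = xs⊆ys (here refl)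

module _ {n : ℕ} where

  Enumeration : List (Fin n) → Set
  Enumeration xs = Unique xs × (∀ v → v ∈ xs)

  Unique⇒length≤ : {xs : List (Fin n)} → Unique xs → length xs ≤ n
  Unique⇒length≤ {xs} xs! =
    subst (length xs ≤_) (length-tabulate id) (Unique-⊆⇒length≤ xs! (λ {v} _ → ∈-allFin v))

  Enumeration⇒length≡ : {xs : List (Fin n)} → Enumeration xs → length xs ≡ n
  Enumeration⇒length≡ {xs} (xs! , complete) = ≤-antisym (Unique⇒length≤ xs!)
    (subst (_≤ length xs) (length-tabulate id) (Unique-⊆⇒length≤ (allFin⁺ n) (λ {v} _ → complete v)))

  Enumeration-resp-↭ : {xs ys : List (Fin n)} → xs ↭ ys → Enumeration xs → Enumeration ys
  Enumeration-resp-↭ p (xs! , complete) = Unique-resp-↭ p xs! , λ v → ∈-resp-↭ p (complete v)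

+-double-injective : ∀ {a b} → a + a ≡ b + b → a ≡ b
+-double-injective {a} {b} eq = trans (n≡⌊n+n/2⌋ a) (trans (cong ⌊_/2⌋ eq) (sym (n≡⌊n+n/2⌋ b)))

1+double≢double : ∀ a b → suc (a + a) ≢ b + b
1+double≢double a b eq = even≢odd b a (trans (double b) (trans (sym eq) (cong suc (sym (double a)))))
  where
  double : ∀ m → 2 * m ≡ m + m
  double m = cong (m +_) (+-identityʳ m)

module Graphs (G : Graph) where

  Vertex : Set
  Vertex = Fin (n G)

  adj-sym : ∀ {u v b} → adj G u v ≡ b → adj G v u ≡ b
  adj-sym {u} {v} uv = trans (Graph.sym G v u) uv

  adj⇒≢ : ∀ {u v} → adj G u v ≡ true → u ≢ v
  adj⇒≢ {u} uv refl = contradiction (trans (sym uv) (irrefl G u)) λ ()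

  Near : Vertex → Vertex → Set
  Near u v = u ≡ v ⊎ adj G u v ≡ true

  Complete : Set
  Complete = ∀ {u v} → u ≢ v → adj G u v ≡ true

  InducedP3 : Set
  InducedP3 = ∃[ a ] ∃[ b ] ∃[ c ] (adj G a b ≡ true × adj G b c ≡ true × a ≢ c × adj G a c ≡ false)

  walk⇒near-or-P3 : ∀ {u x v} → Near u x → Walk G x v → Near u v ⊎ InducedP3
  walk⇒near-or-P3 near here = inj₁ near
  walk⇒near-or-P3 {u} near (step {v = y} xy walk) with u ≟ y | adj G u y in uy | near
  ... | yes u≡y | _     | _         = walk⇒near-or-P3 (inj₁ u≡y) walk
  ... | no _    | true  | _         = walk⇒near-or-P3 (inj₂ uy) walk
  ... | no _    | false | inj₁ refl = contradiction (trans (sym xy) uy) λ ()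
  ... | no u≢y  | false | inj₂ ux   = inj₂ (u , _ , y , ux , xy , u≢y , uy)

  connected⇒complete-or-P3 : (∀ u v → Walk G u v) → Complete ⊎ InducedP3
  connected⇒complete-or-P3 walk with any? (λ u → any? λ v → ¬? (u ≟ v) ×-dec (adj G u v Bool.≟ false))
  ... | no ¬nonadjacent = inj₁ adjacent
    where
    adjacent : Complete
    adjacent {u} {v} u≢v with adj G u v in uv
    ... | true  = refl
    ... | false = ⊥-elim (¬nonadjacent (u , v , u≢v , uv))
  ... | yes (u , v , u≢v , u≁v) with walk⇒near-or-P3 (inj₁ refl) (walk u v)
  ...   | inj₁ (inj₁ u≡v) = ⊥-elim (u≢v u≡v)
  ...   | inj₁ (inj₂ uv)  = contradiction (trans (sym uv) u≁v) λ ()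
  ...   | inj₂ p3         = inj₂ p3

module Matchings (G : Graph) where
  open Graphs G public

  Edge : Set
  Edge = Vertex × Vertex

  IsEdge : Edge → Set
  IsEdge e = adj G (proj₁ e) (proj₂ e) ≡ true

  covered : List Edge → List Vertex
  covered = endpoints {G}

  IsMatching : List Edge → Set
  IsMatching es = All IsEdge es × Unique (covered es)

  IsMaximal : List Edge → Set
  IsMaximal es = ∀ u v → adj G u v ≡ true → u ∈ covered es ⊎ v ∈ covered es

  Perfect : List Edge → Set
  Perfect es = ∀ v → v ∈ covered es

  AtMostOneExposed : List Edge → Set
  AtMostOneExposed es = ∀ {s t} → s ∉ covered es → t ∉ covered es → s ≡ t

  isMatching : (M : Matching G) → IsMatching (edges M)
  isMatching M = areEdges M , disjoint M

  toMatching : (es : List Edge) → IsMatching es → Matching G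
  toMatching es (es-edges , es!) = record { edges = es ; areEdges = es-edges ; disjoint = es! }

  length-covered : ∀ es → length (covered es) ≡ length es + length es
  length-covered [] = refl
  length-covered (_ ∷ es) =
    cong suc (trans (cong suc (length-covered es)) (sym (+-suc (length es) (length es))))

  covered-++ : ∀ es fs → covered (es ++ fs) ≡ covered es ++ covered fs
  covered-++ [] fs = refl
  covered-++ ((u , v) ∷ es) fs = cong (λ c → u ∷ v ∷ c) (covered-++ es fs)

  IsMatching-∷ : ∀ {es u v} → u ∉ covered es → v ∉ covered es → adj G u v ≡ true →
                 IsMatching es → IsMatching ((u , v) ∷ es)
  IsMatching-∷ u∉ v∉ uv (es-edges , es!) =
    uv ∷ es-edges , (adj⇒≢ uv ∷ ¬Any⇒All¬ _ u∉) ∷ ¬Any⇒All¬ _ v∉ ∷ es!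

  ExposedEdge : List Edge → Set
  ExposedEdge es = ∃[ u ] ∃[ v ] (u ∉ covered es × v ∉ covered es × adj G u v ≡ true)

  exposedEdge? : ∀ es → Dec (ExposedEdge es)
  exposedEdge? es = any? λ u → any? λ v →
    ¬? (u ∈? covered es) ×-dec ¬? (v ∈? covered es) ×-dec (adj G u v Bool.≟ true)

  ¬ExposedEdge⇒IsMaximal : ∀ {es} → ¬ ExposedEdge es → IsMaximal es
  ¬ExposedEdge⇒IsMaximal {es} ¬exposed u v uv with u ∈? covered es | v ∈? covered es
  ... | yes u∈ | _      = inj₁ u∈
  ... | no _   | yes v∈ = inj₂ v∈
  ... | no u∉  | no v∉  = ⊥-elim (¬exposed (u , v , u∉ , v∉ , uv))

  record MaximalExtension (es : List Edge) : Set where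
    field
      added    : List Edge
      matching : IsMatching (added ++ es)
      maximal  : IsMaximal (added ++ es)

  extend-within : ∀ fuel es → IsMatching es → n G ≤ length (covered es) + fuel → MaximalExtension es
  extend-within fuel es M bound with exposedEdge? es
  ... | no ¬exposed = record { added = [] ; matching = M ; maximal = ¬ExposedEdge⇒IsMaximal {es} ¬exposed }
  ... | yes (u , v , u∉ , v∉ , uv) with fuel | IsMatching-∷ u∉ v∉ uv M
  ...   | zero | M′ = ⊥-elim (<-irrefl refl (≤-trans (n≤1+n _)
            (≤-trans (Unique⇒length≤ (proj₂ M′)) (subst (n G ≤_) (+-identityʳ _) bound))))
  ...   | suc fuel | M′ = record
          { added    = added ++ (u , v) ∷ []
          ; matching = subst IsMatching (sym (++-assoc added _ es)) matching
          ; maximal  = subst IsMaximal (sym (++-assoc added _ es)) maximal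
          }
    where
    open MaximalExtension (extend-within fuel ((u , v) ∷ es) M′
      (≤-trans (subst (n G ≤_) (+-suc (length (covered es)) fuel) bound) (n≤1+n _)))

  extend : ∀ es → IsMatching es → MaximalExtension es
  extend es M = extend-within (n G) es M (m≤n+m (n G) _)

  record Partner (es : List Edge) (v : Vertex) : Set where
    field
      partner       : Vertex
      others        : List Edge
      adjacent      : adj G v partner ≡ true
      others-edges  : All IsEdge others
      covered-↭     : covered es ↭ v ∷ partner ∷ covered others
      length-others : length es ≡ suc (length others)

  partnerOf : ∀ {es v} → All IsEdge es → v ∈ covered es → Partner es v
  partnerOf {(u , w) ∷ es} (uw ∷ es-edges) (here refl) =
    record { partner = w ; others = es ; adjacent = uw ; others-edges = es-edges
           ; covered-↭ = ↭-refl ; length-others = refl }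
  partnerOf {(u , w) ∷ es} (uw ∷ es-edges) (there (here refl)) =
    record { partner = u ; others = es ; adjacent = adj-sym uw ; others-edges = es-edges
           ; covered-↭ = ↭-swap u w ↭-refl ; length-others = refl }
  partnerOf {(u , w) ∷ es} {v} (uw ∷ es-edges) (there (there v∈)) = record
    { partner       = partner
    ; others        = (u , w) ∷ others
    ; adjacent      = adjacent
    ; others-edges  = uw ∷ others-edges
    ; covered-↭     = ↭-trans (↭-prep u (↭-prep w covered-↭)) (shifts (u ∷ w ∷ []) (v ∷ partner ∷ []))
    ; length-others = cong suc length-others
    }
    where open Partner (partnerOf es-edges v∈)

  module _ {es v} (P : Partner es v) where
    open Partner P

    Partner-flip : Partner es partner
    Partner-flip = record
      { partner = v ; others = others ; adjacent = adj-sym adjacent ; others-edges = others-edges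
      ; covered-↭ = ↭-trans covered-↭ (↭-swap v partner ↭-refl) ; length-others = length-others }

    ∈-covered : ∀ {z} → z ∈ v ∷ partner ∷ covered others → z ∈ covered es
    ∈-covered = ∈-resp-↭ (↭-sym covered-↭)

    module _ {s} (es! : Unique (covered es)) (s∉ : s ∉ covered es) (sv : adj G s v ≡ true) where
      rematched : List Edge
      rematched = (s , v) ∷ others

      rematched-matching : IsMatching rematched
      rematched-matching with Unique-resp-↭ covered-↭ es!
      ... | v∉ ∷ _ ∷ others! = IsMatching-∷ (s∉ ∘ ∈-covered ∘ there ∘ there) (All¬⇒¬Any (All.tail v∉))
                                 sv (others-edges , others!)

      exposed-rematched : ∀ {x} → x ∉ covered es → x ≢ s → x ∉ covered rematched
      exposed-rematched x∉ x≢s (here x≡s) = x≢s x≡s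
      exposed-rematched x∉ x≢s (there (here refl)) = x∉ (∈-covered (here refl))
      exposed-rematched x∉ x≢s (there (there x∈)) = x∉ (∈-covered (there (there x∈)))

      partner-exposed : partner ∉ covered rematched
      partner-exposed (here refl) = s∉ (∈-covered (there (here refl)))
      partner-exposed (there (here refl)) = adj⇒≢ adjacent refl
      partner-exposed (there (there p∈)) with Unique-resp-↭ covered-↭ es!
      ... | _ ∷ p∉ ∷ _ = All¬⇒¬Any p∉ p∈

  exposed-nonadjacent : ∀ {es s t} → IsMaximal es → s ∉ covered es → t ∉ covered es → adj G s t ≡ false
  exposed-nonadjacent {s = s} {t} maximal s∉ t∉ with adj G s t in st
  ... | false = refl
  ... | true with maximal s t st
  ...   | inj₁ s∈ = ⊥-elim (s∉ s∈)
  ...   | inj₂ t∈ = ⊥-elim (t∉ t∈)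

  complete-maximal⇒AtMostOneExposed : Complete → ∀ {es} → IsMaximal es → AtMostOneExposed es
  complete-maximal⇒AtMostOneExposed complete {es} maximal {s} {t} s∉ t∉ with s ≟ t
  ... | yes s≡t = s≡t
  ... | no s≢t  = contradiction (trans (sym (complete s≢t)) (exposed-nonadjacent {es} maximal s∉ t∉)) λ ()

  Perfect⇒length : ∀ {es} → IsMatching es → Perfect es → length es + length es ≡ n G
  Perfect⇒length {es} (_ , es!) perfect =
    trans (sym (length-covered es)) (Enumeration⇒length≡ (es! , perfect))

  AtMostOneExposed⇒Perfect : Even G → ∀ {es} → IsMatching es → AtMostOneExposed es → Perfect es
  AtMostOneExposed⇒Perfect (k , n≡k+k) {es} (_ , es!) one v with v ∈? covered es
  ... | yes v∈ = v∈
  ... | no v∉ = ⊥-elim (1+double≢double (length es) k (begin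
      suc (length es + length es) ≡⟨ cong suc (length-covered es) ⟨
      length (v ∷ covered es)     ≡⟨ Enumeration⇒length≡ (¬Any⇒All¬ _ v∉ ∷ es! , only-v) ⟩
      n G                         ≡⟨ n≡k+k ⟩
      k + k                       ∎))
    where
    open ≡-Reasoning
    only-v : ∀ z → z ∈ v ∷ covered es
    only-v z with z ∈? covered es
    ... | yes z∈ = there z∈
    ... | no z∉ = here (one z∉ v∉)

  maximal-AtMostOneExposed⇒equimatchable : Even G →
    (∀ {es} → IsMatching es → IsMaximal es → AtMostOneExposed es) → Equimatchable G
  maximal-AtMostOneExposed⇒equimatchable even one M M′ M-maximal M′-maximal =
    +-double-injective (trans (twice-size M M-maximal) (sym (twice-size M′ M′-maximal)))
    where
    twice-size : (M : Matching G) → Maximal G M → size M + size M ≡ n G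
    twice-size M M-maximal = Perfect⇒length (isMatching M)
      (AtMostOneExposed⇒Perfect even (isMatching M) (one (isMatching M) M-maximal))

  equimatchable⇒same-size-maximal : Equimatchable G → (M : Matching G) → Maximal G M →
    ∀ {es} → IsMatching es → length es ≡ size M → IsMaximal es
  equimatchable⇒same-size-maximal equimatchable M M-max {es} es-matching len with exposedEdge? es
  ... | no ¬exposed = ¬ExposedEdge⇒IsMaximal {es} ¬exposed
  ... | yes (u , v , u∉ , v∉ , uv) = ⊥-elim (m≢1+n+m (size M) (begin
      size M                             ≡⟨ equimatchable M (toMatching _ matching) M-max maximal ⟩
      length (added ++ (u , v) ∷ es)     ≡⟨ length-++ added ⟩
      length added + suc (length es)     ≡⟨ +-suc (length added) _ ⟩
      suc (length added + length es)     ≡⟨ cong (λ l → suc (length added + l)) len ⟩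
      suc (length added + size M)        ∎))
    where
    open ≡-Reasoning
    open MaximalExtension (extend _ (IsMatching-∷ u∉ v∉ uv es-matching))

module ExposedVertices (G : Graph) (claw-free : ClawFree G) (m : ℕ)
  (same-size⇒maximal : ∀ {es} → Matchings.IsMatching G es → length es ≡ m → Matchings.IsMaximal G es) where
  open Matchings G

  record Stage (t v : Vertex) : Set where
    field
      es          : List Edge
      es-matching : IsMatching es
      es-size     : length es ≡ m
      s           : Vertex
      s-exposed   : s ∉ covered es
      t-exposed   : t ∉ covered es
      s≢t         : s ≢ t
      s-near-v    : Near s v

  rematch-stage : ∀ {t v w u} (st : Stage t v) → let open Stage st in
    (P : Partner es u) → adj G s u ≡ true → Near (Partner.partner P) w → Stage t w
  rematch-stage st P su near = record
    { es          = rematched P (proj₂ es-matching) s-exposed su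
    ; es-matching = rematched-matching P (proj₂ es-matching) s-exposed su
    ; es-size     = trans (sym (Partner.length-others P)) es-size
    ; s           = Partner.partner P
    ; s-exposed   = partner-exposed P (proj₂ es-matching) s-exposed su
    ; t-exposed   = exposed-rematched P (proj₂ es-matching) s-exposed su t-exposed (s≢t ∘ sym)
    ; s≢t         = λ { refl → t-exposed (∈-covered P (there (here refl))) }
    ; s-near-v    = near
    }
    where open Stage st

  reposition : ∀ {t v w} (st : Stage t v) → Near (Stage.s st) w → Stage t w
  reposition st near = record { Stage st hiding (s-near-v) ; s-near-v = near }

  module _ {t v w} (st : Stage t v) (vw : adj G v w ≡ true) where
    open Stage st

    module _ (sv : adj G s v ≡ true) (P : Partner es v) where
      open Partner P renaming (partner to p)

      s≢p : s ≢ p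
      s≢p refl = s-exposed (∈-covered P (there (here refl)))

      rematch-or-claw : Stage t w
      rematch-or-claw with s ≟ w | adj G s w in sw | p ≟ w | adj G p w in pw | adj G s p in sp
      ... | yes s≡w | _     | _      | _     | _     = reposition st (inj₁ s≡w)
      ... | no _    | true  | _      | _     | _     = reposition st (inj₂ sw)
      ... | no _    | false | yes p≡w | _    | _     = rematch-stage st P sv (inj₁ p≡w)
      ... | no _    | false | no _   | true  | _     = rematch-stage st P sv (inj₂ pw)
      ... | no _    | false | no _   | false | true  = rematch-stage st (Partner-flip P) sp (inj₂ vw)
      ... | no s≢w  | false | no p≢w | false | false =
        ⊥-elim (claw-free v s w p (adj-sym sv , vw , adjacent , s≢w , s≢p , p≢w ∘ sym , sw , sp , adj-sym pw))

    exchange : adj G s v ≡ true → Stage t w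
    exchange sv with same-size⇒maximal es-matching es-size s v sv
    ... | inj₁ s∈ = ⊥-elim (s-exposed s∈)
    ... | inj₂ v∈ = rematch-or-claw sv (partnerOf (proj₁ es-matching) v∈)

  advance : ∀ {t v w} → Stage t v → adj G v w ≡ true → Stage t w
  advance st vw with Stage.s-near-v st
  ... | inj₁ refl = reposition st (inj₂ vw)
  ... | inj₂ sv   = exchange st vw sv

  stuck : ∀ {t v} → Stage t v → Walk G v t → ⊥
  stuck st (step vw walk) = stuck (advance st vw) walk
  stuck st here with Stage.s-near-v st
  ... | inj₁ s≡t = Stage.s≢t st s≡t
  ... | inj₂ st-adj with same-size⇒maximal (Stage.es-matching st) (Stage.es-size st) _ _ st-adj
  ...   | inj₁ s∈ = Stage.s-exposed st s∈
  ...   | inj₂ t∈ = Stage.t-exposed st t∈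

  walk⇒exposed-equal : ∀ {es} → IsMatching es → length es ≡ m →
    ∀ {s t} → s ∉ covered es → t ∉ covered es → Walk G s t → s ≡ t
  walk⇒exposed-equal {es} es-matching es-size {s} {t} s∉ t∉ walk with s ≟ t
  ... | yes s≡t = s≡t
  ... | no s≢t = ⊥-elim (stuck (record
    { es = es ; es-matching = es-matching ; es-size = es-size ; s = s ; s-exposed = s∉
    ; t-exposed = t∉ ; s≢t = s≢t ; s-near-v = inj₁ refl }) walk)

equimatchable⇒maximal-perfect : (G : Graph) → Connected G → ClawFree G → Even G → Equimatchable G →
  ∀ {es} → Matchings.IsMatching G es → Matchings.IsMaximal G es → Matchings.Perfect G es
equimatchable⇒maximal-perfect G (_ , walk) claw-free even equimatchable {es} es-matching es-maximal =
  AtMostOneExposed⇒Perfect even es-matching λ s∉ t∉ →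
    walk⇒exposed-equal es-matching refl s∉ t∉ (walk _ _)
  where
  open Matchings G
  open ExposedVertices G claw-free (length es)
    (equimatchable⇒same-size-maximal equimatchable (toMatching es es-matching) es-maximal)

module RandomlyMatchable (G : Graph) (claw-free : ClawFree G) (walk : ∀ u v → Walk G u v)
  (maximal⇒perfect : ∀ {es} → Matchings.IsMatching G es → Matchings.IsMaximal G es → Matchings.Perfect G es)
  where
  open Matchings G
  open import Algebra.Solver.CommutativeMonoid (++-commutativeMonoid {A = Vertex}) using (solve; _⊕_; _⊜_)

  leftover-adjacent : ∀ {Z a c} → All IsEdge Z → Enumeration (a ∷ c ∷ covered Z) → adj G a c ≡ true
  leftover-adjacent {Z} {a} {c} Z-edges ((a∉ ∷ _ ∷ Z!) , complete) with adj G a c in ac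
  ... | true  = refl
  ... | false = ⊥-elim (All.lookup a∉ (there (maximal⇒perfect (Z-edges , Z!) Z-maximal a)) refl)
    where
    Z-maximal : IsMaximal Z
    Z-maximal u v uv with complete u | complete v
    ... | there (there u∈) | _                  = inj₁ u∈
    ... | _                | there (there v∈)   = inj₂ v∈
    ... | here refl        | here refl          = ⊥-elim (adj⇒≢ uv refl)
    ... | there (here refl) | there (here refl) = ⊥-elim (adj⇒≢ uv refl)
    ... | here refl        | there (here refl)  = contradiction (trans (sym uv) ac) λ ()
    ... | there (here refl) | here refl         = contradiction (trans (sym (adj-sym uv)) ac) λ ()

  leftover-adjacent-in : ∀ {L Z a c} → Enumeration L → All IsEdge Z → a ∷ c ∷ covered Z ↭ L → adj G a c ≡ true
  leftover-adjacent-in L-enum Z-edges π = leftover-adjacent Z-edges (Enumeration-resp-↭ (↭-sym π) L-enum)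

  -- R leaves exactly p q r s x y exposed. In each case four of them are matched along edges so
  -- that the remaining two must be adjacent; the last case is a claw at q.
  4-cycle-has-no-outer-neighbour : ∀ {p q r s x y R} → All IsEdge R →
    Enumeration (p ∷ q ∷ r ∷ s ∷ x ∷ y ∷ covered R) →
    adj G p q ≡ true → adj G q r ≡ true → adj G r s ≡ true → adj G s p ≡ true → adj G p r ≡ false →
    adj G q x ≡ true → ⊥
  4-cycle-has-no-outer-neighbour {p} {q} {r} {s} {x} {y} {R} R-edges enum pq qr rs sp p≁r qx
    with adj G r x in rx | adj G p x in px
  ... | true | _ = contradiction (trans (sym pr) p≁r) λ ()
    where
    sy : adj G s y ≡ true
    sy = leftover-adjacent-in enum (rx ∷ pq ∷ R-edges) (solve 7
      (λ p q r s x y rest → s ⊕ y ⊕ r ⊕ x ⊕ p ⊕ q ⊕ rest ⊜ p ⊕ q ⊕ r ⊕ s ⊕ x ⊕ y ⊕ rest)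
      ↭-refl [ p ] [ q ] [ r ] [ s ] [ x ] [ y ] (covered R))
    pr : adj G p r ≡ true
    pr = leftover-adjacent-in enum (qx ∷ sy ∷ R-edges) (solve 7
      (λ p q r s x y rest → p ⊕ r ⊕ q ⊕ x ⊕ s ⊕ y ⊕ rest ⊜ p ⊕ q ⊕ r ⊕ s ⊕ x ⊕ y ⊕ rest)
      ↭-refl [ p ] [ q ] [ r ] [ s ] [ x ] [ y ] (covered R))
  ... | false | true = contradiction (trans (sym (adj-sym xr)) rx) λ ()
    where
    qy : adj G q y ≡ true
    qy = leftover-adjacent-in enum (px ∷ rs ∷ R-edges) (solve 7
      (λ p q r s x y rest → q ⊕ y ⊕ p ⊕ x ⊕ r ⊕ s ⊕ rest ⊜ p ⊕ q ⊕ r ⊕ s ⊕ x ⊕ y ⊕ rest)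
      ↭-refl [ p ] [ q ] [ r ] [ s ] [ x ] [ y ] (covered R))
    xr : adj G x r ≡ true
    xr = leftover-adjacent-in enum (adj-sym sp ∷ qy ∷ R-edges) (solve 7
      (λ p q r s x y rest → x ⊕ r ⊕ p ⊕ s ⊕ q ⊕ y ⊕ rest ⊜ p ⊕ q ⊕ r ⊕ s ⊕ x ⊕ y ⊕ rest)
      ↭-refl [ p ] [ q ] [ r ] [ s ] [ x ] [ y ] (covered R))
  ... | false | false with proj₁ enum
  ...   | p∉ ∷ _ ∷ r∉ ∷ _ =
    claw-free q p r x (adj-sym pq , qr , qx , All.lookup p∉ (there (here refl)) ,
      All.lookup p∉ (there (there (there (here refl)))) , All.lookup r∉ (there (here refl)) , p≁r , px , rx)

  module Square {a b c c′ R} (R-edges : All IsEdge R) (enum : Enumeration (a ∷ b ∷ c ∷ c′ ∷ covered R))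
    (ab : adj G a b ≡ true) (bc : adj G b c ≡ true) (cc′ : adj G c c′ ≡ true) (a≁c : adj G a c ≡ false)
    where

    ac′ : adj G a c′ ≡ true
    ac′ = leftover-adjacent-in enum (bc ∷ R-edges) (solve 5
      (λ a b c c′ rest → a ⊕ c′ ⊕ b ⊕ c ⊕ rest ⊜ a ⊕ b ⊕ c ⊕ c′ ⊕ rest)
      ↭-refl [ a ] [ b ] [ c ] [ c′ ] (covered R))

    b≁c′ : adj G b c′ ≡ false
    b≁c′ with adj G b c′ in bc′
    ... | false = refl
    ... | true  = contradiction (trans (sym ac) a≁c) λ ()
      where
      ac : adj G a c ≡ true
      ac = leftover-adjacent-in enum (bc′ ∷ R-edges) (solve 5
        (λ a b c c′ rest → a ⊕ c ⊕ b ⊕ c′ ⊕ rest ⊜ a ⊕ b ⊕ c ⊕ c′ ⊕ rest)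
        ↭-refl [ a ] [ b ] [ c ] [ c′ ] (covered R))

    corners : List Vertex
    corners = a ∷ b ∷ c ∷ c′ ∷ []

    corner-has-no-outer-neighbour : ∀ {u x} → u ∈ corners → x ∈ covered R → adj G u x ≡ true → ⊥
    corner-has-no-outer-neighbour {u} {x} u∈ x∈ ux = at-corner u∈
      where
      open Partner (partnerOf R-edges x∈) renaming (partner to y)
      rest = covered others
      enum′ : Enumeration (a ∷ b ∷ c ∷ c′ ∷ x ∷ y ∷ rest)
      enum′ = Enumeration-resp-↭ (↭-prep a (↭-prep b (↭-prep c (↭-prep c′ covered-↭)))) enum
      relabelled : ∀ {xs} → xs ↭ a ∷ b ∷ c ∷ c′ ∷ x ∷ y ∷ rest → Enumeration xs
      relabelled π = Enumeration-resp-↭ (↭-sym π) enum′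
      at-corner : u ∈ corners → ⊥
      at-corner (here refl) = 4-cycle-has-no-outer-neighbour others-edges
        (relabelled (solve 7
          (λ a b c c′ x y rest → b ⊕ a ⊕ c′ ⊕ c ⊕ x ⊕ y ⊕ rest ⊜ a ⊕ b ⊕ c ⊕ c′ ⊕ x ⊕ y ⊕ rest)
          ↭-refl [ a ] [ b ] [ c ] [ c′ ] [ x ] [ y ] rest))
        (adj-sym ab) ac′ (adj-sym cc′) (adj-sym bc) b≁c′ ux
      at-corner (there (here refl)) =
        4-cycle-has-no-outer-neighbour others-edges enum′ ab bc cc′ (adj-sym ac′) a≁c ux
      at-corner (there (there (here refl))) = 4-cycle-has-no-outer-neighbour others-edges
        (relabelled (solve 7
          (λ a b c c′ x y rest → c′ ⊕ c ⊕ b ⊕ a ⊕ x ⊕ y ⊕ rest ⊜ a ⊕ b ⊕ c ⊕ c′ ⊕ x ⊕ y ⊕ rest)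
          ↭-refl [ a ] [ b ] [ c ] [ c′ ] [ x ] [ y ] rest))
        (adj-sym cc′) (adj-sym bc) (adj-sym ab) ac′ (adj-sym b≁c′) ux
      at-corner (there (there (there (here refl)))) = 4-cycle-has-no-outer-neighbour others-edges
        (relabelled (solve 7
          (λ a b c c′ x y rest → c ⊕ c′ ⊕ a ⊕ b ⊕ x ⊕ y ⊕ rest ⊜ a ⊕ b ⊕ c ⊕ c′ ⊕ x ⊕ y ⊕ rest)
          ↭-refl [ a ] [ b ] [ c ] [ c′ ] [ x ] [ y ] rest))
        cc′ (adj-sym ac′) ab bc (adj-sym a≁c) ux

    corners-closed : ∀ {u v} → u ∈ corners → Walk G u v → v ∈ corners
    corners-closed u∈ here = u∈
    corners-closed u∈ (step uw walk) with ∈-++⁻ corners (proj₂ enum _)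
    ... | inj₁ w∈  = corners-closed w∈ walk
    ... | inj₂ w∈R = ⊥-elim (corner-has-no-outer-neighbour u∈ w∈R uw)

    corner : Fin 4 → Vertex
    corner = lookup corners

    corner-index : Vertex → Fin 4
    corner-index v = index (corners-closed (here refl) (walk a v))

    corner∘corner-index : ∀ v → corner (corner-index v) ≡ v
    corner∘corner-index v = sym (lookup-index (corners-closed (here refl) (walk a v)))

    corner-index∘corner : ∀ i → corner-index (corner i) ≡ i
    corner-index∘corner i =
      Unique-lookup-injective (Unique-++⁻ˡ corners (proj₁ enum)) (corner∘corner-index (corner i))

    corner-adj : ∀ i j → adj G (corner i) (corner j) ≡ c4adj i j
    corner-adj 0F 0F = irrefl G a
    corner-adj 0F 1F = ab
    corner-adj 0F 2F = a≁c
    corner-adj 0F 3F = ac′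
    corner-adj 1F 0F = adj-sym ab
    corner-adj 1F 1F = irrefl G b
    corner-adj 1F 2F = bc
    corner-adj 1F 3F = b≁c′
    corner-adj 2F 0F = adj-sym a≁c
    corner-adj 2F 1F = adj-sym bc
    corner-adj 2F 2F = irrefl G c
    corner-adj 2F 3F = cc′
    corner-adj 3F 0F = adj-sym ac′
    corner-adj 3F 1F = adj-sym b≁c′
    corner-adj 3F 2F = adj-sym cc′
    corner-adj 3F 3F = irrefl G c′

    ≅C4 : G ≅ C4
    ≅C4 = record
      { bij      = mk↔ₛ′ corner-index corner corner-index∘corner corner∘corner-index
      ; preserve = λ u v → trans (sym (cong₂ (adj G) (corner∘corner-index u) (corner∘corner-index v)))
                                 (corner-adj (corner-index u) (corner-index v))
      }

  P3⇒≅C4 : InducedP3 → G ≅ C4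
  P3⇒≅C4 (a , b , c , ab , bc , a≢c , a≁c) = at (proj₂ enum c)
    where
    open MaximalExtension (extend ((a , b) ∷ []) (IsMatching-∷ (λ ()) (λ ()) ab ([] , [])))
    enum : Enumeration (a ∷ b ∷ covered added)
    enum = Enumeration-resp-↭
      (subst (_↭ a ∷ b ∷ covered added) (sym (covered-++ added _)) (++-comm (covered added) (a ∷ b ∷ [])))
      (proj₂ matching , maximal⇒perfect matching maximal)
    at : c ∈ a ∷ b ∷ covered added → G ≅ C4
    at (here c≡a) = ⊥-elim (a≢c (sym c≡a))
    at (there (here c≡b)) = ⊥-elim (adj⇒≢ bc (sym c≡b))
    at (there (there c∈)) = Square.≅C4 others-edges
      (Enumeration-resp-↭ (↭-prep a (↭-prep b covered-↭)) enum) ab bc adjacent a≁c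
      where open Partner (partnerOf (++⁻ˡ added (proj₁ matching)) c∈)

  complete-or-≅C4 : Complete ⊎ G ≅ C4
  complete-or-≅C4 with connected⇒complete-or-P3 walk
  ... | inj₁ complete = inj₁ complete
  ... | inj₂ p3       = inj₂ (P3⇒≅C4 p3)

module Isomorphism {G H : Graph} (G≅H : G ≅ H) where
  open _≅_ G≅H public

  to : Fin (n G) → Fin (n H)
  to = Inverse.to bij

  from : Fin (n H) → Fin (n G)
  from = Inverse.from bij

  to-≢ : ∀ {u v} → u ≢ v → to u ≢ to v
  to-≢ u≢v = u≢v ∘ Injection.injective (↔⇒↣ bij)

  adj-to : ∀ {u v b} → adj G u v ≡ b → adj H (to u) (to v) ≡ b
  adj-to {u} {v} uv = trans (sym (preserve u v)) uv

  Complete-≅ : Graphs.Complete H → Graphs.Complete G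
  Complete-≅ complete {u} {v} u≢v = trans (preserve u v) (complete (to-≢ u≢v))

K-complete : ∀ m → Graphs.Complete (K m)
K-complete m {i} {j} i≢j with toℕ i ≡ᵇ toℕ j in eq
... | true  = ⊥-elim (i≢j (toℕ-injective (≡ᵇ⇒≡ (toℕ i) (toℕ j) (subst T (sym eq) tt))))
... | false = refl

complete⇒≅K : (G : Graph) → Graphs.Complete G → G ≅ K (n G)
complete⇒≅K G complete = record { bij = ↔-id _ ; preserve = preserve }
  where
  preserve : ∀ u v → adj G u v ≡ adj (K (n G)) u v
  preserve u v with u ≟ v
  ... | yes refl = trans (irrefl G u) (sym (irrefl (K (n G)) u))
  ... | no u≢v   = trans (complete u≢v) (sym (K-complete (n G) u≢v))

C4-third-vertex : ∀ (i j : Fin 4) → ∃[ k ] (k ≢ i × k ≢ j)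
C4-third-vertex = from-yes (all? λ (i : Fin 4) → all? λ (j : Fin 4) → any? λ (k : Fin 4) →
  ¬? (k ≟ i) ×-dec ¬? (k ≟ j))

C4-no-independent-triple : ∀ (i j k : Fin 4) →
  ¬ (i ≢ j × i ≢ k × j ≢ k × c4adj i j ≡ false × c4adj i k ≡ false × c4adj j k ≡ false)
C4-no-independent-triple = from-yes (all? λ (i : Fin 4) → all? λ (j : Fin 4) → all? λ (k : Fin 4) →
  ¬? (¬? (i ≟ j) ×-dec ¬? (i ≟ k) ×-dec ¬? (j ≟ k) ×-dec
      c4adj i j Bool.≟ false ×-dec c4adj i k Bool.≟ false ×-dec c4adj j k Bool.≟ false))

C4-non-edge-complement : ∀ (i j k l : Fin 4) →
  ¬ (i ≢ j × i ≢ k × i ≢ l × j ≢ k × j ≢ l × k ≢ l × c4adj i j ≡ false × c4adj k l ≡ true)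
C4-non-edge-complement = from-yes (all? λ (i : Fin 4) → all? λ (j : Fin 4) →
  all? λ (k : Fin 4) → all? λ (l : Fin 4) →
  ¬? (¬? (i ≟ j) ×-dec ¬? (i ≟ k) ×-dec ¬? (i ≟ l) ×-dec ¬? (j ≟ k) ×-dec ¬? (j ≟ l) ×-dec
      ¬? (k ≟ l) ×-dec
      c4adj i j Bool.≟ false ×-dec c4adj k l Bool.≟ true))

module _ {G : Graph} (G≅C4 : G ≅ C4) where
  open Matchings G
  open Isomorphism G≅C4

  third-vertex : ∀ s t → ∃[ w ] (w ≢ s × w ≢ t)
  third-vertex s t with C4-third-vertex (to s) (to t)
  ... | k , k≢s , k≢t = from k , (λ { refl → k≢s (sym to∘from) }) , (λ { refl → k≢t (sym to∘from) })
    where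
    to∘from : to (from k) ≡ k
    to∘from = Inverse.strictlyInverseˡ bij k

  -- Two exposed vertices s ≠ t are non-adjacent, and a third vertex w either forms an
  -- independent triple with them or is matched along an edge disjoint from the non-edge s t.
  module _ {es} (es-edges : All IsEdge es) (maximal : IsMaximal es) where
    nonadjacent : ∀ {u v} → u ∉ covered es → v ∉ covered es → adj G u v ≡ false
    nonadjacent = exposed-nonadjacent {es} maximal

    ≅C4-maximal⇒AtMostOneExposed : AtMostOneExposed es
    ≅C4-maximal⇒AtMostOneExposed {s} {t} s∉ t∉ with s ≟ t
    ... | yes s≡t = s≡t
    ... | no s≢t with third-vertex s t
    ...   | w , w≢s , w≢t with w ∈? covered es
    ...     | no w∉ = ⊥-elim (C4-no-independent-triple (to s) (to t) (to w)
              (to-≢ s≢t , to-≢ (w≢s ∘ sym) , to-≢ (w≢t ∘ sym) , adj-to (nonadjacent s∉ t∉) ,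
               adj-to (nonadjacent s∉ w∉) , adj-to (nonadjacent t∉ w∉)))
    ...     | yes w∈ = ⊥-elim (C4-non-edge-complement (to s) (to t) (to w) (to w′)
              (to-≢ s≢t , to-≢ (w≢s ∘ sym) , to-≢ (w′≢ s∉ ∘ sym) , to-≢ (w≢t ∘ sym) ,
               to-≢ (w′≢ t∉ ∘ sym) , to-≢ (adj⇒≢ adjacent) , adj-to (nonadjacent s∉ t∉) , adj-to adjacent))
      where
      P = partnerOf es-edges w∈
      open Partner P renaming (partner to w′)
      w′≢ : ∀ {x} → x ∉ covered es → w′ ≢ x
      w′≢ x∉ refl = x∉ (∈-covered P (there (here refl)))

positive-half : ∀ {m k} → 1 ≤ m → m ≡ k + k → 1 ≤ k
positive-half {k = zero} () refl
positive-half {k = suc k} _ _ = s≤s z≤n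

proposition1 : (G : Graph) → Connected G → ClawFree G → Even G →
    Equimatchable G ⇔ ((∃[ p ] (1 ≤ p × G ≅ K (p + p))) ⊎ G ≅ C4)
proposition1 G connected@(1≤n , walk) claw-free even@(k , n≡k+k) = mk⇔ forward backward
  where
  open Matchings G

  forward : Equimatchable G → (∃[ p ] (1 ≤ p × G ≅ K (p + p))) ⊎ G ≅ C4
  forward equimatchable with RandomlyMatchable.complete-or-≅C4 G claw-free walk
    (equimatchable⇒maximal-perfect G connected claw-free even equimatchable)
  ... | inj₁ complete =
    inj₁ (k , positive-half 1≤n n≡k+k , subst (λ m → G ≅ K m) n≡k+k (complete⇒≅K G complete))
  ... | inj₂ G≅C4     = inj₂ G≅C4

  backward : (∃[ p ] (1 ≤ p × G ≅ K (p + p))) ⊎ G ≅ C4 → Equimatchable G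
  backward (inj₁ (_ , _ , G≅K)) = maximal-AtMostOneExposed⇒equimatchable even λ {es} _ maximal →
    complete-maximal⇒AtMostOneExposed (Isomorphism.Complete-≅ G≅K (K-complete _)) {es} maximal
  backward (inj₂ G≅C4) = maximal-AtMostOneExposed⇒equimatchable even λ matching maximal →
    ≅C4-maximal⇒AtMostOneExposed G≅C4 (proj₁ matching) maximal
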